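{- Let $(\mathcal K,r_n)$ and $(\mathcal K,r_n')$ be pre-extenders of the $n$-maniplex $\mathcal K$. The following are equivalent: (1) there is an isomorphism $\varphi:\mathcal U(\mathcal K,r_n)\to\mathcal U(\mathcal K,r_n')$ that acts as the identity on the base facet, i.e. $(\Phi,1)\varphi=(\Phi,1)$ for every flag $\Phi$ of $\mathcal K$; (2) there is an $(r_n,r_n')$-friendly set $S\subseteq\Gamma(\mathcal K)$ containing the identity; (3) $\mathcal K_{r_n}/\heartsuit(\mathcal K,r_n)=\mathcal K_{r_n'}/\heartsuit(\mathcal K,r_n')$ (equality, not merely isomorphism, of quotient premaniplexes on the flag set of $\mathcal K$).
   Context: An $n$-premaniplex is a graph (semi-edges and parallel edges allowed) whose vertices, called flags, carry a proper edge colouring with colours $0,\dots,n-1$, each flag $\Phi$ having exactly one incident dart of each colour $i$, with other end $r_i\Phi$; one requires $r_ir_jr_ir_j=1$ for $|i-j|>1$. An $n$-maniplex is a connected $n$-premaniplex in which $r_i$ and $r_ir_j$ ($i\ne j$) have no fixed points. Facets are components after deleting colour-$(n-1)$ edges. Automorphisms are colour-preserving and act on the right; $\Gamma(\mathcal K)$ is the automorphism group. A pre-extender $(\mathcal K,r_n)$ is a permutation $r_n$ of the flags of $\mathcal K$ with $r_n^2=1$ commuting with $r_0,\dots,r_{n-2}$. The pre-extension $\mathcal K_{r_n}$ is the $(n+1)$-premaniplex with the flags and $i$-adjacencies ($i<n$) of $\mathcal K$ and $n$-adjacency $\Phi\mapsto r_n\Phi$. The universal Cayley extension $\mathcal U(\mathcal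 K,r_n)$ has flags $(\Phi,\gamma)$, $\gamma\in G(\mathcal K,r_n)=\langle\alpha_F\ (F\text{ a facet})\mid\alpha_F\alpha_{r_n(F)}=1\rangle$, with $(\Phi,\gamma)$ $i$-adjacent to $(r_i\Phi,\gamma)$ for $i<n$ and $n$-adjacent to $(r_n\Phi,\alpha_F\gamma)$, $F$ the facet of $\Phi$. A set $S\subseteq\Gamma(\mathcal K)$ is $(r_n,r_n')$-friendly if for every flag $\Phi$ and every $\tau\in S$ there is $\bar\tau\in S$ with $r_n'(\Phi\tau)=(r_n\Phi)\bar\tau$; $r_n$-friendly means $(r_n,r_n)$-friendly. $\heartsuit(\mathcal K,r_n)$ is the union of all $r_n$-friendly subsets of $\Gamma(\mathcal K)$ (a subgroup). For an $r_n$-friendly subgroup $H$, $\mathcal K_{r_n}/H$ is the premaniplex with vertices the orbits $\Phi H$, where $\Phi H$ is $i$-adjacent to $(r_i\Phi)H$ for $0\le i\le n$. -}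

module Defs where

open import Data.Nat using (ℕ; zero; suc; _<_; ∣_-_∣)
open import Data.Fin using (Fin; zero; suc; toℕ)
open import Data.List using (List; []; _∷_; _++_)
open import Data.List.Relation.Unary.All using (All)
open import Data.Bool using (Bool; true; false; not)
open import Data.Product using (Σ; ∃; _×_; _,_)
open import Function.Bundles using (_⇔_)
open import Relation.Binary.PropositionalEquality using (_≡_; _≢_)

walk : ∀ {n} {A : Set} → (Fin n → A → A) → List (Fin n) → A → A
walk r []      Φ = Φ
walk r (i ∷ w) Φ = walk r w (r i Φ)

-- n-maniplexes.  A premaniplex is given by its flag set and the
-- involutions r_i (r_i Φ is the other end of the i-dart at Φ; semi-edges
-- are fixed points, parallel edges are allowed).

record Maniplex (n : ℕ) : Set₁ where
  field
    Flag      : Set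
    r         : Fin n → Flag → Flag
    r-invol   : ∀ i Φ → r i (r i Φ) ≡ Φ
    r-comm    : ∀ i j → 1 < ∣ toℕ i - toℕ j ∣ → ∀ Φ → r i (r j (r i (r j Φ))) ≡ Φ
    connected : ∀ Φ Ψ → ∃ λ (w : List (Fin n)) → walk r w Φ ≡ Ψ
    r-nofix   : ∀ i Φ → r i Φ ≢ Φ
    rr-nofix  : ∀ i j → i ≢ j → ∀ Φ → r i (r j Φ) ≢ Φ

module _ {n : ℕ} (K : Maniplex n) where
  open Maniplex K

  FacetColour : Fin n → Set
  FacetColour i = suc (toℕ i) < n

  SameFacet : Flag → Flag → Set
  SameFacet Φ Ψ = ∃ λ (w : List (Fin n)) → All FacetColour w × walk r w Φ ≡ Ψ

  record PreExtender : Set where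
    field
      rn       : Flag → Flag
      rn-invol : ∀ Φ → rn (rn Φ) ≡ Φ
      rn-comm  : ∀ i → FacetColour i → ∀ Φ → rn (r i Φ) ≡ r i (rn Φ)

  -- The group G(K, r_n) = ⟨ α_F | α_F α_{r_n F} = 1 ⟩, given by its
  -- presentation: words in the letters α_Φ^{±1} (Φ a flag; (true , Φ)
  -- is α_F and (false , Φ) is α_F⁻¹ for F the facet of Φ), modulo the
  -- congruence generated by free reduction, α_Φ = α_Ψ for Φ,Ψ in the
  -- same facet, and the relators α_F α_{r_n F}.

  Word : Set
  Word = List (Bool × Flag)

  data _≈[_]_ : Word → (Flag → Flag) → Word → Set where
    ≈refl  : ∀ {rn w} → w ≈[ rn ] w
    ≈sym   : ∀ {rn w v} → w ≈[ rn ] v → v ≈[ rn ] w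
    ≈trans : ∀ {rn u v w} → u ≈[ rn ] v → v ≈[ rn ] w → u ≈[ rn ] w
    ≈cong  : ∀ {rn w w′ v v′} → w ≈[ rn ] w′ → v ≈[ rn ] v′ → (w ++ v) ≈[ rn ] (w′ ++ v′)
    ≈inv   : ∀ {rn} b Φ → ((not b , Φ) ∷ (b , Φ) ∷ []) ≈[ rn ] []
    ≈facet : ∀ {rn Φ Ψ} → SameFacet Φ Ψ → ((true , Φ) ∷ []) ≈[ rn ] ((true , Ψ) ∷ [])
    ≈rel   : ∀ {rn} Φ → ((true , Φ) ∷ (true , rn Φ) ∷ []) ≈[ rn ] []

  -- Extending the colouring by an n-th involution (colour n = last).

  extend : ∀ {m} {A : Set} → (Fin m → A → A) → (A → A) → Fin (suc m) → A → A
  extend {zero}  ρ ρn zero    = ρn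
  extend {suc m} ρ ρn zero    = ρ zero
  extend {suc m} ρ ρn (suc i) = extend (λ j → ρ (suc j)) ρn i

  -- The universal Cayley extension U(K, r_n): flags (Φ , γ), γ ∈ G(K,r_n)
  -- (a setoid: flags are equal iff Φ ≡ Ψ and γ ≈ δ in G).

  UFlag : Set
  UFlag = Flag × Word

  _≈U[_]_ : UFlag → (Flag → Flag) → UFlag → Set
  (Φ , γ) ≈U[ rn ] (Ψ , δ) = (Φ ≡ Ψ) × (γ ≈[ rn ] δ)

  Ur : (Flag → Flag) → Fin (suc n) → UFlag → UFlag
  Ur rn = extend (λ i x → r i (Data.Product.proj₁ x) , Data.Product.proj₂ x)
                 (λ x → rn (Data.Product.proj₁ x) , ((true , Data.Product.proj₁ x) ∷ Data.Product.proj₂ x))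

  record UIso (rn rn′ : Flag → Flag) : Set where
    field
      to      : UFlag → UFlag
      from    : UFlag → UFlag
      to-cong   : ∀ {x y} → x ≈U[ rn ] y → to x ≈U[ rn′ ] to y
      from-cong : ∀ {x y} → x ≈U[ rn′ ] y → from x ≈U[ rn ] from y
      to-from : ∀ x → to (from x) ≈U[ rn′ ] x
      from-to : ∀ x → from (to x) ≈U[ rn ] x
      to-colour : ∀ i x → to (Ur rn i x) ≈U[ rn′ ] Ur rn′ i (to x)

  -- The automorphism group Γ(K) (acting on the right: Φτ = act τ Φ).

  record Aut : Set where
    field
      act      : Flag → Flag
      act⁻¹    : Flag → Flag
      act-inv₁ : ∀ Φ → act (act⁻¹ Φ) ≡ Φ
      act-inv₂ : ∀ Φ → act⁻¹ (act Φ) ≡ Φ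
      act-col  : ∀ i Φ → act (r i Φ) ≡ r i (act Φ)
  open Aut public

  AutSet : Set₁
  AutSet = Aut → Set

  Friendly : (Flag → Flag) → (Flag → Flag) → AutSet → Set
  Friendly rn rn′ S = ∀ Φ τ → S τ → Σ Aut λ τ̄ → S τ̄ × (rn′ (act τ Φ) ≡ act τ̄ (rn Φ))

  ContainsId : AutSet → Set
  ContainsId S = Σ Aut λ τ → S τ × (∀ Φ → act τ Φ ≡ Φ)

  Heart : (Flag → Flag) → Aut → Set₁
  Heart rn τ = Σ AutSet λ S → Friendly rn rn S × S τ

  -- Quotients K_{r_n} / H.  The vertex of Φ is the orbit ΦH (a subset of
  -- flags), and its i-neighbour is (r_i Φ)H, 0 ≤ i ≤ n.

  Orbit : (Aut → Set₁) → Flag → Flag → Set₁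
  Orbit H Φ Ψ = Σ Aut λ τ → H τ × (Ψ ≡ act τ Φ)

  _≐_ : (Flag → Set₁) → (Flag → Set₁) → Set₁
  P ≐ Q = ∀ Ψ → P Ψ ⇔ Q Ψ

  QuotientEq : (Flag → Flag) → (Aut → Set₁) → (Flag → Flag) → (Aut → Set₁) → Set₁
  QuotientEq rn H rn′ H′ =
    (∀ Φ → Orbit H Φ ≐ Orbit H′ Φ) ×
    (∀ (i : Fin (suc n)) Φ → Orbit H (extend r rn i Φ) ≐ Orbit H′ (extend r rn′ i Φ))

{-# OPTIONS --safe #-}
-- Given a friendly set S ∋ 1, a word γ in the generators α_F can be transported letter by
-- letter: reading γ from the right while carrying some τ ∈ S, the letter α_Ψ becomes α_{Ψτ}
-- and τ is replaced by the element τ̄ that friendliness attaches to the n-edge at Ψ. This gives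
-- colour-preserving maps U(K, r_n) ⇄ U(K, r_n′) fixing the base facet; such a map is unique,
-- since every flag is reached from the base facet by lower-colour walks and n-edges, so the
-- two maps are mutually inverse. Conversely, an isomorphism fixing the base facet acts on each
-- slice {(Φ , γ)} as an automorphism, and these automorphisms form a friendly set.
-- For the quotients, conjugating by S turns r_n-friendly sets into r_n′-friendly ones, so
-- ♥(r_n) = ♥(r_n′), and r_n′ Φ ∈ (r_n Φ) S ⊆ (r_n Φ) ♥ makes the n-adjacencies agree.
-- Conversely, the submonoid generated by the friendly sets exhibiting r_n′ Φ ∈ (r_n Φ) ♥
-- is (r_n, r_n′)-friendly.
module Submission where

open import Defs
open import Data.Nat using (ℕ; zero; suc)
open import Data.Fin using (Fin; zero; suc; inject₁; fromℕ)
open import Data.List using (List; []; _∷_; _++_; [_])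
open import Data.List.Relation.Unary.All using (All; []; _∷_)
open import Data.Bool using (Bool; true; false)
open import Data.Product using (Σ; _×_; _,_; proj₁; proj₂)
open import Function.Base using (id; _∘_)
open import Function.Bundles using (_⇔_; mk⇔; Equivalence)
open import Function.Properties.Equivalence using () renaming (sym to ⇔-sym; trans to ⇔-trans)
open import Level using (0ℓ)
open import Relation.Binary.Bundles using (Setoid)
import Relation.Binary.Reasoning.Setoid as SetoidReasoning
open import Relation.Binary.PropositionalEquality
  using (_≡_; _≗_; refl; sym; trans; cong; cong₂; subst; subst₂; module ≡-Reasoning)

module Theory {n : ℕ} (K : Maniplex n) where
  open Maniplex K

  extend-preserves : ∀ {m ℓ} {A B : Set} (P : (A → A) → (B → B) → Set ℓ)
    {ρ : Fin m → A → A} {ρn : A → A} {σ : Fin m → B → B} {σn : B → B} →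
    (∀ j → P (ρ j) (σ j)) → P ρn σn → ∀ i → P (extend K ρ ρn i) (extend K σ σn i)
  extend-preserves {zero}  P lower top zero    = top
  extend-preserves {suc m} P lower top zero    = lower zero
  extend-preserves {suc m} P lower top (suc i) = extend-preserves P (λ j → lower (suc j)) top i

  extend-inject₁ : ∀ {m} {A : Set} (ρ : Fin m → A → A) (ρn : A → A) j →
                   extend K ρ ρn (inject₁ j) ≗ ρ j
  extend-inject₁ {suc m} ρ ρn zero    x = refl
  extend-inject₁ {suc m} ρ ρn (suc j) x = extend-inject₁ (λ k → ρ (suc k)) ρn j x

  extend-fromℕ : ∀ {m} {A : Set} (ρ : Fin m → A → A) (ρn : A → A) →
                 extend K ρ ρn (fromℕ m) ≗ ρn
  extend-fromℕ {zero}  ρ ρn x = refl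
  extend-fromℕ {suc m} ρ ρn x = extend-fromℕ (λ k → ρ (suc k)) ρn x

  rn-walk : (P : PreExtender K) → ∀ w → All (FacetColour K) w → ∀ Φ →
            PreExtender.rn P (walk r w Φ) ≡ walk r w (PreExtender.rn P Φ)
  rn-walk P []      []       Φ = refl
  rn-walk P (i ∷ w) (c ∷ cs) Φ =
    trans (rn-walk P w cs (r i Φ)) (cong (walk r w) (PreExtender.rn-comm P i c Φ))

  idᴬ : Aut K
  idᴬ = record
    { act = id ; act⁻¹ = id ; act-inv₁ = λ _ → refl ; act-inv₂ = λ _ → refl
    ; act-col = λ _ _ → refl }

  infix  8 _⁻¹ᴬ _⁻¹ˢ
  infixl 7 _·ᴬ_ _⊙_

  _⁻¹ᴬ : Aut K → Aut K
  τ ⁻¹ᴬ = record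
    { act = act⁻¹ τ ; act⁻¹ = act τ ; act-inv₁ = act-inv₂ τ ; act-inv₂ = act-inv₁ τ
    ; act-col = inverse-col }
    where
    open ≡-Reasoning
    inverse-col : ∀ i Φ → act⁻¹ τ (r i Φ) ≡ r i (act⁻¹ τ Φ)
    inverse-col i Φ = begin
      act⁻¹ τ (r i Φ)                    ≡⟨ cong (act⁻¹ τ ∘ r i) (act-inv₁ τ Φ) ⟨
      act⁻¹ τ (r i (act τ (act⁻¹ τ Φ)))  ≡⟨ cong (act⁻¹ τ) (act-col τ i (act⁻¹ τ Φ)) ⟨
      act⁻¹ τ (act τ (r i (act⁻¹ τ Φ)))  ≡⟨ act-inv₂ τ (r i (act⁻¹ τ Φ)) ⟩
      r i (act⁻¹ τ Φ)                    ∎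

  -- Automorphisms act on the right: σ ·ᴬ τ first applies σ, then τ.
  _·ᴬ_ : Aut K → Aut K → Aut K
  σ ·ᴬ τ = record
    { act = act τ ∘ act σ ; act⁻¹ = act⁻¹ σ ∘ act⁻¹ τ
    ; act-inv₁ = λ Φ → trans (cong (act τ) (act-inv₁ σ (act⁻¹ τ Φ))) (act-inv₁ τ Φ)
    ; act-inv₂ = λ Φ → trans (cong (act⁻¹ σ) (act-inv₂ τ (act σ Φ))) (act-inv₂ σ Φ)
    ; act-col = λ i Φ → trans (cong (act τ) (act-col σ i Φ)) (act-col τ i (act σ Φ)) }

  ⁻¹ᴬ-id : (τ : Aut K) → act τ ≗ id → act⁻¹ τ ≗ id
  ⁻¹ᴬ-id τ τ-id Φ = trans (cong (act⁻¹ τ) (sym (τ-id Φ))) (act-inv₂ τ Φ)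

  act-walk : (τ : Aut K) → ∀ w Φ → act τ (walk r w Φ) ≡ walk r w (act τ Φ)
  act-walk τ []      Φ = refl
  act-walk τ (i ∷ w) Φ = trans (act-walk τ w (r i Φ)) (cong (walk r w) (act-col τ i Φ))

  act-rigid : (σ τ : Aut K) {Φ : Flag} → act σ Φ ≡ act τ Φ → act σ ≗ act τ
  act-rigid σ τ {Φ} eq Ψ with connected Φ Ψ
  ... | w , refl = begin
    act σ (walk r w Φ)  ≡⟨ act-walk σ w Φ ⟩
    walk r w (act σ Φ)  ≡⟨ cong (walk r w) eq ⟩
    walk r w (act τ Φ)  ≡⟨ act-walk τ w Φ ⟨
    act τ (walk r w Φ)  ∎
    where open ≡-Reasoning

  -- Friendly sets and the group ♥

  _⁻¹ˢ : AutSet K → AutSet K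
  (S ⁻¹ˢ) τ = Σ (Aut K) λ σ → S σ × act τ ≗ act⁻¹ σ

  _⊙_ : AutSet K → AutSet K → AutSet K
  (S ⊙ T) τ = Σ (Aut K) λ σ → Σ (Aut K) λ ρ → S σ × T ρ × act τ ≗ act (σ ·ᴬ ρ)

  ⁻¹ˢ-intro : ∀ {S σ} → S σ → (S ⁻¹ˢ) (σ ⁻¹ᴬ)
  ⁻¹ˢ-intro {σ = σ} σ∈S = σ , σ∈S , λ _ → refl

  ⊙-intro : ∀ {S T σ ρ} → S σ → T ρ → (S ⊙ T) (σ ·ᴬ ρ)
  ⊙-intro {σ = σ} {ρ} σ∈S ρ∈T = σ , ρ , σ∈S , ρ∈T , λ _ → refl

  friendly-⁻¹ : ∀ {rn rn′ S} → Friendly K rn rn′ S → Friendly K rn′ rn (S ⁻¹ˢ)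
  friendly-⁻¹ {rn} {rn′} fr Φ τ (σ , σ∈S , τ≗σ⁻¹) with fr (act τ Φ) σ σ∈S
  ... | σ̄ , σ̄∈S , eq = σ̄ ⁻¹ᴬ , ⁻¹ˢ-intro σ̄∈S , (begin
    rn (act τ Φ)                     ≡⟨ act-inv₂ σ̄ (rn (act τ Φ)) ⟨
    act⁻¹ σ̄ (act σ̄ (rn (act τ Φ)))  ≡⟨ cong (act⁻¹ σ̄) eq ⟨
    act⁻¹ σ̄ (rn′ (act σ (act τ Φ)))  ≡⟨ cong (act⁻¹ σ̄ ∘ rn′ ∘ act σ) (τ≗σ⁻¹ Φ) ⟩
    act⁻¹ σ̄ (rn′ (act σ (act⁻¹ σ Φ))) ≡⟨ cong (act⁻¹ σ̄ ∘ rn′) (act-inv₁ σ Φ) ⟩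
    act⁻¹ σ̄ (rn′ Φ)                  ∎)
    where open ≡-Reasoning

  friendly-⊙ : ∀ {rn rn′ rn″ S T} → Friendly K rn rn′ S → Friendly K rn′ rn″ T →
               Friendly K rn rn″ (S ⊙ T)
  friendly-⊙ {rn} {rn′} {rn″} frS frT Φ τ (σ , ρ , σ∈S , ρ∈T , τ≗σρ)
    with frS Φ σ σ∈S | frT (act σ Φ) ρ ρ∈T
  ... | σ̄ , σ̄∈S , eqσ | ρ̄ , ρ̄∈T , eqρ = σ̄ ·ᴬ ρ̄ , ⊙-intro σ̄∈S ρ̄∈T , (begin
    rn″ (act τ Φ)            ≡⟨ cong rn″ (τ≗σρ Φ) ⟩
    rn″ (act ρ (act σ Φ))    ≡⟨ eqρ ⟩
    act ρ̄ (rn′ (act σ Φ))    ≡⟨ cong (act ρ̄) eqσ ⟩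
    act ρ̄ (act σ̄ (rn Φ))     ∎)
    where open ≡-Reasoning

  containsId-⁻¹ : ∀ {S} → ContainsId K S → ContainsId K (S ⁻¹ˢ)
  containsId-⁻¹ (e , e∈S , e-id) = e ⁻¹ᴬ , ⁻¹ˢ-intro e∈S , ⁻¹ᴬ-id e e-id

  heart-id : ∀ {rn} → Heart K rn idᴬ
  heart-id {rn} = (λ τ → act τ ≗ id) , friendly , (λ _ → refl)
    where
    friendly : Friendly K rn rn (λ τ → act τ ≗ id)
    friendly Φ τ τ-id = τ , τ-id , trans (cong rn (τ-id Φ)) (sym (τ-id (rn Φ)))

  heart-·ᴬ : ∀ {rn σ τ} → Heart K rn σ → Heart K rn τ → Heart K rn (σ ·ᴬ τ)
  heart-·ᴬ {rn} (S , frS , σ∈S) (T , frT , τ∈T) =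
    S ⊙ T , friendly-⊙ {rn} {rn} {rn} frS frT , ⊙-intro σ∈S τ∈T

  heart-⁻¹ᴬ : ∀ {rn τ} → Heart K rn τ → Heart K rn (τ ⁻¹ᴬ)
  heart-⁻¹ᴬ (S , frS , τ∈S) = S ⁻¹ˢ , friendly-⁻¹ frS , ⁻¹ˢ-intro τ∈S

  heart-⊆ : ∀ {rn rn′ S} → Friendly K rn rn′ S → ContainsId K S →
            ∀ {τ} → Heart K rn τ → Heart K rn′ τ
  heart-⊆ {rn} {rn′} {S} frS (e , e∈S , e-id) {τ} (T , frT , τ∈T) =
    S ⁻¹ˢ ⊙ T ⊙ S ,
    friendly-⊙ {rn′} {rn} {rn′} (friendly-⊙ {rn′} {rn} {rn} (friendly-⁻¹ frS) frT) frS ,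
    (e ⁻¹ᴬ ·ᴬ τ , e , ⊙-intro {S ⁻¹ˢ} {T} {e ⁻¹ᴬ} {τ} (⁻¹ˢ-intro e∈S) τ∈T , e∈S , conjugate)
    where
    conjugate : act τ ≗ act ((e ⁻¹ᴬ ·ᴬ τ) ·ᴬ e)
    conjugate Φ = trans (cong (act τ) (sym (⁻¹ᴬ-id e e-id Φ))) (sym (e-id _))

  friendly-⊆-heart : ∀ {rn rn′ S s} → Friendly K rn rn′ S → ContainsId K S → S s → Heart K rn s
  friendly-⊆-heart {rn} {rn′} {S} {s} frS (e , e∈S , e-id) s∈S =
    S ⊙ S ⁻¹ˢ , friendly-⊙ {rn} {rn′} {rn} frS (friendly-⁻¹ frS) ,
    (s , e ⁻¹ᴬ , s∈S , ⁻¹ˢ-intro {S} e∈S , λ Φ → sym (⁻¹ᴬ-id e e-id (act s Φ)))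

  _≐ᶠ_ : (Flag → Set₁) → (Flag → Set₁) → Set₁
  A ≐ᶠ B = _≐_ K A B

  orbit-mono : ∀ {H H′ : Aut K → Set₁} → (∀ {τ} → H τ → H′ τ) →
               ∀ {Φ Ψ} → Orbit K H Φ Ψ → Orbit K H′ Φ Ψ
  orbit-mono H⊆H′ (τ , τ∈H , eq) = τ , H⊆H′ τ∈H , eq

  orbit-shift : ∀ {rn s} → Heart K rn s → ∀ Φ →
                Orbit K (Heart K rn) (act s Φ) ≐ᶠ Orbit K (Heart K rn) Φ
  orbit-shift {s = s} s∈♥ Φ Ψ = mk⇔
    (λ (τ , τ∈♥ , eq) → s ·ᴬ τ , heart-·ᴬ s∈♥ τ∈♥ , eq)
    (λ (τ , τ∈♥ , eq) → s ⁻¹ᴬ ·ᴬ τ , heart-·ᴬ (heart-⁻¹ᴬ s∈♥) τ∈♥ ,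
                        trans eq (cong (act τ) (sym (act-inv₂ s Φ))))

  quotientEq-intro : ∀ {rn rn′ H H′} →
    (∀ Φ → Orbit K H Φ ≐ᶠ Orbit K H′ Φ) →
    (∀ Φ → Orbit K H (rn Φ) ≐ᶠ Orbit K H′ (rn′ Φ)) →
    QuotientEq K rn H rn′ H′
  quotientEq-intro {H = H} {H′} same top =
    same , extend-preserves (λ f g → ∀ Φ → Orbit K H (f Φ) ≐ᶠ Orbit K H′ (g Φ))
                            (λ j Φ → same (r j Φ)) top

  quotientEq-top : ∀ {rn rn′ H H′} → QuotientEq K rn H rn′ H′ →
                   ∀ Φ → Orbit K H (rn Φ) ≐ᶠ Orbit K H′ (rn′ Φ)
  quotientEq-top {rn} {rn′} {H} {H′} (_ , adjacent) Φ =
    subst₂ (λ X Y → Orbit K H X ≐ᶠ Orbit K H′ Y)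
           (extend-fromℕ r rn Φ) (extend-fromℕ r rn′ Φ) (adjacent (fromℕ n) Φ)

  friendly⇒quotientEq : ∀ {rn rn′ S} → Friendly K rn rn′ S → ContainsId K S →
                        QuotientEq K rn (Heart K rn) rn′ (Heart K rn′)
  friendly⇒quotientEq {rn} {rn′} frS cid@(e , e∈S , e-id) =
    quotientEq-intro same-orbits top-orbits
    where
    same-orbits : ∀ Φ → Orbit K (Heart K rn) Φ ≐ᶠ Orbit K (Heart K rn′) Φ
    same-orbits Φ Ψ = mk⇔ (orbit-mono (heart-⊆ frS cid))
                          (orbit-mono (heart-⊆ (friendly-⁻¹ frS) (containsId-⁻¹ cid)))

    top-orbits : ∀ Φ → Orbit K (Heart K rn) (rn Φ) ≐ᶠ Orbit K (Heart K rn′) (rn′ Φ)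
    top-orbits Φ with frS Φ e e∈S
    ... | s , s∈S , eq = subst (λ X → Orbit K (Heart K rn) (rn Φ) ≐ᶠ Orbit K (Heart K rn′) X)
      (trans (sym eq) (cong rn′ (e-id Φ)))
      (λ Ψ → ⇔-trans (⇔-sym (orbit-shift (friendly-⊆-heart {rn} {rn′} frS cid s∈S) (rn Φ) Ψ))
                     (same-orbits (act s (rn Φ)) Ψ))

  ⋃ : {I : Set} → (I → AutSet K) → AutSet K
  ⋃ {I} T τ = Σ I λ i → T i τ

  ⋃-friendly : ∀ {rn rn′ I} {T : I → AutSet K} → (∀ i → Friendly K rn rn′ (T i)) →
               Friendly K rn rn′ (⋃ T)
  ⋃-friendly frT Φ τ (i , τ∈Tᵢ) with frT i Φ τ τ∈Tᵢ
  ... | τ̄ , τ̄∈Tᵢ , eq = τ̄ , (i , τ̄∈Tᵢ) , eq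

  product : ∀ {S : AutSet K} → List (Σ (Aut K) S) → Aut K
  product []             = idᴬ
  product ((σ , _) ∷ l) = σ ·ᴬ product l

  Submonoid : AutSet K → AutSet K
  Submonoid S τ = Σ (List (Σ (Aut K) S)) λ l → act τ ≗ act (product l)

  submonoid-id : ∀ {S} → Submonoid S idᴬ
  submonoid-id = [] , λ _ → refl

  product-∷ʳ : ∀ {S} (l : List (Σ (Aut K) S)) x →
               act (product (l ++ [ x ])) ≗ act (proj₁ x) ∘ act (product l)
  product-∷ʳ []      x Φ = refl
  product-∷ʳ (y ∷ l) x Φ = product-∷ʳ l x (act (proj₁ y) Φ)

  submonoid-·ᴬ : ∀ {S τ σ} → Submonoid S τ → S σ → Submonoid S (τ ·ᴬ σ)
  submonoid-·ᴬ {σ = σ} (l , τ≗l) σ∈S =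
    l ++ [ σ , σ∈S ] , λ Φ → trans (cong (act σ) (τ≗l Φ)) (sym (product-∷ʳ l (σ , σ∈S) Φ))

  product-friendly : ∀ {rn S} → Friendly K rn rn S → ∀ (l : List (Σ (Aut K) S)) Φ →
                     Σ (List (Σ (Aut K) S)) λ l̄ → rn (act (product l) Φ) ≡ act (product l̄) (rn Φ)
  product-friendly frS []              Φ = [] , refl
  product-friendly frS ((σ , σ∈S) ∷ l) Φ with frS Φ σ σ∈S | product-friendly frS l (act σ Φ)
  ... | σ̄ , σ̄∈S , eqσ | l̄ , eql = (σ̄ , σ̄∈S) ∷ l̄ , trans eql (cong (act (product l̄)) eqσ)

  submonoid-friendly : ∀ {rn S} → Friendly K rn rn S → Friendly K rn rn (Submonoid S)
  submonoid-friendly {rn} frS Φ τ (l , τ≗l) with product-friendly frS l Φ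
  ... | l̄ , eq = product l̄ , (l̄ , λ _ → refl) , trans (cong rn (τ≗l Φ)) eq

  -- Products are needed: rn′ (Φτ) = (rn Φ) τ̄ h, with τ̄ from friendliness and h the witness at Φτ.
  heart-orbit⇒friendly : ∀ {rn rn′} → (∀ Φ → Orbit K (Heart K rn) (rn Φ) (rn′ Φ)) →
                         Σ (AutSet K) λ S → Friendly K rn rn′ S × ContainsId K S
  heart-orbit⇒friendly {rn} {rn′} witness =
    Submonoid (⋃ T) , friendly , (idᴬ , submonoid-id , λ _ → refl)
    where
    h : Flag → Aut K
    h Φ = proj₁ (witness Φ)
    T : Flag → AutSet K
    T Φ = proj₁ (proj₁ (proj₂ (witness Φ)))
    T-friendly : ∀ Φ → Friendly K rn rn (T Φ)
    T-friendly Φ = proj₁ (proj₂ (proj₁ (proj₂ (witness Φ))))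
    h∈T : ∀ Φ → T Φ (h Φ)
    h∈T Φ = proj₂ (proj₂ (proj₁ (proj₂ (witness Φ))))
    rn′≡ : ∀ Φ → rn′ Φ ≡ act (h Φ) (rn Φ)
    rn′≡ Φ = proj₂ (proj₂ (witness Φ))

    friendly : Friendly K rn rn′ (Submonoid (⋃ T))
    friendly Φ τ τ∈M with submonoid-friendly (⋃-friendly {rn} {rn} T-friendly) Φ τ τ∈M
    ... | τ̄ , τ̄∈M , eq =
      τ̄ ·ᴬ h (act τ Φ) ,
      submonoid-·ᴬ {⋃ T} {τ̄} {h (act τ Φ)} τ̄∈M (act τ Φ , h∈T (act τ Φ)) ,
      trans (rn′≡ (act τ Φ)) (cong (act (h (act τ Φ))) eq)

  quotientEq⇒friendly : ∀ {rn rn′} → QuotientEq K rn (Heart K rn) rn′ (Heart K rn′) →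
                        Σ (AutSet K) λ S → Friendly K rn rn′ S × ContainsId K S
  quotientEq⇒friendly {rn′ = rn′} q = heart-orbit⇒friendly λ Φ →
    Equivalence.from (quotientEq-top q Φ (rn′ Φ)) (idᴬ , heart-id , refl)

  -- Colour-preserving maps between universal Cayley extensions

  _≈ᵂ[_]_ : Word K → (Flag → Flag) → Word K → Set
  γ ≈ᵂ[ rn ] δ = _≈[_]_ K γ rn δ

  _≈ᵁ[_]_ : UFlag K → (Flag → Flag) → UFlag K → Set
  x ≈ᵁ[ rn ] y = _≈U[_]_ K x rn y

  U-setoid : (Flag → Flag) → Setoid 0ℓ 0ℓ
  U-setoid rn = record
    { Carrier       = UFlag K
    ; _≈_           = λ x y → x ≈ᵁ[ rn ] y
    ; isEquivalence = record
      { refl  = refl , ≈refl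
      ; sym   = λ (p , q) → sym p , ≈sym q
      ; trans = λ (p , q) (p′ , q′) → trans p p′ , ≈trans q q′ } }

  module ≈ᵁ {rn : Flag → Flag} = Setoid (U-setoid rn)

  letter-flag : (Flag → Flag) → Bool × Flag → Flag
  letter-flag rn (true  , Φ) = Φ
  letter-flag rn (false , Φ) = rn Φ

  -- α_F⁻¹ = α_{rn F}
  letter-positive : ∀ {rn} l → [ l ] ≈ᵂ[ rn ] [ true , letter-flag rn l ]
  letter-positive (true  , Φ) = ≈refl
  letter-positive (false , Φ) =
    ≈trans (≈sym (≈cong (≈refl {w = [ false , Φ ]}) (≈rel Φ))) (≈cong (≈inv true Φ) ≈refl)

  Ur-lower : Fin n → UFlag K → UFlag K
  Ur-lower i x = r i (proj₁ x) , proj₂ x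

  Ur-top : (Flag → Flag) → UFlag K → UFlag K
  Ur-top rn x = rn (proj₁ x) , (true , proj₁ x) ∷ proj₂ x

  Ur-walk : List (Fin n) → UFlag K → UFlag K
  Ur-walk w x = walk r w (proj₁ x) , proj₂ x

  Ur-top-cong : ∀ {rn x y} → x ≈ᵁ[ rn ] y → Ur-top rn x ≈ᵁ[ rn ] Ur-top rn y
  Ur-top-cong {x = Φ , _} (refl , q) = refl , ≈cong (≈refl {w = [ true , Φ ]}) q

  Ur-walk-cong : ∀ {rn} w {x y} → x ≈ᵁ[ rn ] y → Ur-walk w x ≈ᵁ[ rn ] Ur-walk w y
  Ur-walk-cong w (p , q) = cong (walk r w) p , q

  Ur-cong : ∀ {rn} i {x y} → x ≈ᵁ[ rn ] y → Ur K rn i x ≈ᵁ[ rn ] Ur K rn i y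
  Ur-cong {rn} = extend-preserves (λ f g → ∀ {x y} → x ≈ᵁ[ rn ] y → f x ≈ᵁ[ rn ] g y)
                   (λ j (p , q) → cong (r j) p , q) Ur-top-cong

  record Hom (rn rn′ : Flag → Flag) : Set where
    field
      map        : UFlag K → UFlag K
      map-cong   : ∀ {x y} → x ≈ᵁ[ rn ] y → map x ≈ᵁ[ rn′ ] map y
      map-colour : ∀ i x → map (Ur K rn i x) ≈ᵁ[ rn′ ] Ur K rn′ i (map x)
  open Hom

  idᴴ : ∀ {rn} → Hom rn rn
  idᴴ = record { map = id ; map-cong = id ; map-colour = λ _ _ → ≈ᵁ.refl }

  _·ᴴ_ : ∀ {rn rn′ rn″} → Hom rn rn′ → Hom rn′ rn″ → Hom rn rn″
  F ·ᴴ G = record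
    { map        = map G ∘ map F
    ; map-cong   = map-cong G ∘ map-cong F
    ; map-colour = λ i x → ≈ᵁ.trans (map-cong G (map-colour F i x)) (map-colour G i (map F x)) }

  hom-intro : ∀ {rn rn′} (f : UFlag K → UFlag K) →
    (∀ {x y} → x ≈ᵁ[ rn ] y → f x ≈ᵁ[ rn′ ] f y) →
    (∀ j x → f (Ur-lower j x) ≈ᵁ[ rn′ ] Ur-lower j (f x)) →
    (∀ x → f (Ur-top rn x) ≈ᵁ[ rn′ ] Ur-top rn′ (f x)) → Hom rn rn′
  hom-intro {rn} {rn′} f f-cong lower top = record
    { map = f ; map-cong = f-cong
    ; map-colour = extend-preserves (λ g g′ → ∀ x → f (g x) ≈ᵁ[ rn′ ] g′ (f x)) lower top }

  module _ {rn rn′ : Flag → Flag} (F : Hom rn rn′) where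
    open SetoidReasoning (U-setoid rn′)

    map-lower : ∀ j x → map F (Ur-lower j x) ≈ᵁ[ rn′ ] Ur-lower j (map F x)
    map-lower j x = begin
      map F (Ur-lower j x)           ≡⟨ cong (map F) (extend-inject₁ Ur-lower (Ur-top rn) j x) ⟨
      map F (Ur K rn (inject₁ j) x)  ≈⟨ map-colour F (inject₁ j) x ⟩
      Ur K rn′ (inject₁ j) (map F x) ≡⟨ extend-inject₁ Ur-lower (Ur-top rn′) j (map F x) ⟩
      Ur-lower j (map F x)           ∎

    map-top : ∀ x → map F (Ur-top rn x) ≈ᵁ[ rn′ ] Ur-top rn′ (map F x)
    map-top x = begin
      map F (Ur-top rn x)           ≡⟨ cong (map F) (extend-fromℕ Ur-lower (Ur-top rn) x) ⟨
      map F (Ur K rn (fromℕ n) x)   ≈⟨ map-colour F (fromℕ n) x ⟩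
      Ur K rn′ (fromℕ n) (map F x)  ≡⟨ extend-fromℕ Ur-lower (Ur-top rn′) (map F x) ⟩
      Ur-top rn′ (map F x)          ∎

    map-walk : ∀ w x → map F (Ur-walk w x) ≈ᵁ[ rn′ ] Ur-walk w (map F x)
    map-walk []      x = ≈ᵁ.refl
    map-walk (i ∷ w) x = begin
      map F (Ur-walk w (Ur-lower i x))   ≈⟨ map-walk w (Ur-lower i x) ⟩
      Ur-walk w (map F (Ur-lower i x))   ≈⟨ Ur-walk-cong w (map-lower i x) ⟩
      Ur-walk w (Ur-lower i (map F x))   ∎

    map-word-const : ∀ γ Φ Ψ → proj₂ (map F (Φ , γ)) ≈ᵂ[ rn′ ] proj₂ (map F (Ψ , γ))
    map-word-const γ Φ Ψ with connected Φ Ψ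
    ... | w , refl = ≈sym (proj₂ (map-walk w (Φ , γ)))

    map-letter : ∀ w l γ → map F (walk r w (rn (letter-flag rn l)) , l ∷ γ)
                           ≈ᵁ[ rn′ ] Ur-walk w (Ur-top rn′ (map F (letter-flag rn l , γ)))
    map-letter w l γ = begin
      map F (walk r w (rn Ψ) , l ∷ γ)        ≈⟨ map-cong F (refl , ≈cong (letter-positive l) ≈refl) ⟩
      map F (Ur-walk w (Ur-top rn (Ψ , γ)))  ≈⟨ map-walk w (Ur-top rn (Ψ , γ)) ⟩
      Ur-walk w (map F (Ur-top rn (Ψ , γ)))  ≈⟨ Ur-walk-cong w (map-top (Ψ , γ)) ⟩
      Ur-walk w (Ur-top rn′ (map F (Ψ , γ))) ∎
      where
      Ψ : Flag
      Ψ = letter-flag rn l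

  -- (Φ , α_Ψ γ) is reached from (Ψ , γ) by an n-edge followed by a walk in the lower colours.
  hom-unique : ∀ {rn rn′} (F G : Hom rn rn′) → (∀ Φ → map F (Φ , []) ≈ᵁ[ rn′ ] map G (Φ , [])) →
               ∀ x → map F x ≈ᵁ[ rn′ ] map G x
  hom-unique {rn} {rn′} F G base (Φ , γ) = agree γ Φ
    where
    agree : ∀ γ Φ → map F (Φ , γ) ≈ᵁ[ rn′ ] map G (Φ , γ)
    agree []      Φ = base Φ
    agree (l ∷ γ) Φ with connected (rn (letter-flag rn l)) Φ
    ... | w , refl = ≈ᵁ.trans (map-letter F w l γ)
                     (≈ᵁ.trans (Ur-walk-cong w (Ur-top-cong (agree γ (letter-flag rn l))))
                               (≈ᵁ.sym (map-letter G w l γ)))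

  -- Isomorphisms fixing the base facet

  module _ {rn rn′ : Flag → Flag} (φ : UIso K rn rn′) where
    open UIso φ

    toHom : Hom rn rn′
    toHom = record { map = to ; map-cong = to-cong ; map-colour = to-colour }

    fromHom : Hom rn′ rn
    fromHom = record { map = from ; map-cong = from-cong ; map-colour = from-colour }
      where
      open SetoidReasoning (U-setoid rn)
      from-colour : ∀ i y → from (Ur K rn′ i y) ≈ᵁ[ rn ] Ur K rn i (from y)
      from-colour i y = begin
        from (Ur K rn′ i y)              ≈⟨ from-cong (Ur-cong i (to-from y)) ⟨
        from (Ur K rn′ i (to (from y)))  ≈⟨ from-cong (to-colour i (from y)) ⟨
        from (to (Ur K rn i (from y)))   ≈⟨ from-to (Ur K rn i (from y)) ⟩
        Ur K rn i (from y)               ∎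

    -- The inverse may use the word component of (Ψ , γ)φ since it does not depend on Ψ.
    sliceᴬ : Word K → Aut K
    sliceᴬ γ = record
      { act      = λ Φ → proj₁ (to (Φ , γ))
      ; act⁻¹    = λ Ψ → proj₁ (from (Ψ , δ Ψ))
      ; act-inv₁ = λ Ψ → proj₁ (≈ᵁ.trans (to-cong (refl , ≈sym (from-word Ψ))) (to-from (Ψ , δ Ψ)))
      ; act-inv₂ = λ Φ → proj₁ (≈ᵁ.trans (from-cong (refl , map-word-const toHom γ _ Φ))
                                          (from-to (Φ , γ)))
      ; act-col  = λ i Φ → proj₁ (map-lower toHom i (Φ , γ)) }
      where
      δ : Flag → Word K
      δ Ψ = proj₂ (to (Ψ , γ))
      from-word : ∀ Ψ → proj₂ (from (Ψ , δ Ψ)) ≈ᵂ[ rn ] γ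
      from-word Ψ = ≈trans (map-word-const fromHom (δ Ψ) Ψ (proj₁ (to (Ψ , γ))))
                           (proj₂ (from-to (Ψ , γ)))

    iso⇒friendly : (∀ Φ → to (Φ , []) ≈ᵁ[ rn′ ] (Φ , [])) →
                   Σ (AutSet K) λ S → Friendly K rn rn′ S × ContainsId K S
    iso⇒friendly base = S , friendly , (idᴬ , ([] , λ Φ → sym (proj₁ (base Φ))) , λ _ → refl)
      where
      S : AutSet K
      S τ = Σ (Word K) λ γ → act τ ≗ act (sliceᴬ γ)
      friendly : Friendly K rn rn′ S
      friendly Φ τ (γ , τ≗γ) =
        sliceᴬ ((true , Φ) ∷ γ) , ((true , Φ) ∷ γ , λ _ → refl) ,
        trans (cong rn′ (τ≗γ Φ)) (sym (proj₁ (map-top toHom (Φ , γ))))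

  -- Friendly sets containing the identity

  module FriendlyHom (P P′ : PreExtender K) {S : AutSet K}
                     (frS : Friendly K (PreExtender.rn P) (PreExtender.rn P′) S)
                     (e : Aut K) (e∈S : S e) (e-id : act e ≗ id) where
    open PreExtender P
    open PreExtender P′ using () renaming (rn to rn′; rn-invol to rn′-invol)

    State : Set
    State = Σ (Aut K) S

    _≈ˢ_ : State → State → Set
    s ≈ˢ t = act (proj₁ s) ≗ act (proj₁ t)

    step : Flag → State → State
    step Φ (τ , τ∈S) = proj₁ (frS Φ τ τ∈S) , proj₁ (proj₂ (frS Φ τ τ∈S))

    step-act : ∀ Φ s → rn′ (act (proj₁ s) Φ) ≡ act (proj₁ (step Φ s)) (rn Φ)
    step-act Φ (τ , τ∈S) = proj₂ (proj₂ (frS Φ τ τ∈S))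

    step-cong : ∀ Φ {s t} → s ≈ˢ t → step Φ s ≈ˢ step Φ t
    step-cong Φ {s} {t} s≈t = act-rigid (proj₁ (step Φ s)) (proj₁ (step Φ t))
      (trans (sym (step-act Φ s)) (trans (cong rn′ (s≈t Φ)) (step-act Φ t)))

    run : Word K → State → State
    run []      s = s
    run (l ∷ γ) s = step (letter-flag rn l) (run γ s)

    translate : Word K → State → Word K
    translate []      s = []
    translate (l ∷ γ) s = (true , act (proj₁ (run γ s)) (letter-flag rn l)) ∷ translate γ s

    run-cong : ∀ γ {s t} → s ≈ˢ t → run γ s ≈ˢ run γ t
    run-cong []      s≈t = s≈t
    run-cong (l ∷ γ) s≈t = step-cong (letter-flag rn l) (run-cong γ s≈t)

    translate-cong : ∀ γ {s t} → s ≈ˢ t → translate γ s ≡ translate γ t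
    translate-cong []      s≈t = refl
    translate-cong (l ∷ γ) s≈t =
      cong₂ _∷_ (cong (true ,_) (run-cong γ s≈t (letter-flag rn l))) (translate-cong γ s≈t)

    run-++ : ∀ γ δ s → run (γ ++ δ) s ≡ run γ (run δ s)
    run-++ []      δ s = refl
    run-++ (l ∷ γ) δ s = cong (step (letter-flag rn l)) (run-++ γ δ s)

    translate-++ : ∀ γ δ s → translate (γ ++ δ) s ≡ translate γ (run δ s) ++ translate δ s
    translate-++ []      δ s = refl
    translate-++ (l ∷ γ) δ s =
      cong₂ _∷_ (cong (λ t → true , act (proj₁ t) (letter-flag rn l)) (run-++ γ δ s))
                (translate-++ γ δ s)

    step-twice : ∀ {X Y} → rn X ≡ Y → ∀ s →
      step Y (step X s) ≈ˢ s ×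
      ((true , act (proj₁ (step X s)) Y) ∷ (true , act (proj₁ s) X) ∷ []) ≈ᵂ[ rn′ ] []
    step-twice {X} refl s = act-rigid (proj₁ (step (rn X) t)) (proj₁ s) returns , relator
      where
      t : State
      t = step X s
      Z : Flag
      Z = act (proj₁ s) X
      open ≡-Reasoning
      returns : act (proj₁ (step (rn X) t)) X ≡ Z
      returns = begin
        act (proj₁ (step (rn X) t)) X         ≡⟨ cong (act (proj₁ (step (rn X) t))) (rn-invol X) ⟨
        act (proj₁ (step (rn X) t)) (rn (rn X)) ≡⟨ step-act (rn X) t ⟨
        rn′ (act (proj₁ t) (rn X))             ≡⟨ cong rn′ (step-act X s) ⟨
        rn′ (rn′ Z)                            ≡⟨ rn′-invol Z ⟩
        Z                                      ∎
      relator : ((true , act (proj₁ t) (rn X)) ∷ (true , Z) ∷ []) ≈ᵂ[ rn′ ] []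
      relator = subst₂ (λ U V → ((true , U) ∷ (true , V) ∷ []) ≈ᵂ[ rn′ ] [])
                       (step-act X s) (rn′-invol Z) (≈rel (rn′ Z))

    step-facet : ∀ w → All (FacetColour K) w → ∀ Φ s →
      step Φ s ≈ˢ step (walk r w Φ) s ×
      [ true , act (proj₁ s) Φ ] ≈ᵂ[ rn′ ] [ true , act (proj₁ s) (walk r w Φ) ]
    step-facet w cs Φ s =
      act-rigid (proj₁ (step Φ s)) (proj₁ (step Ψ s)) agree ,
      ≈facet (w , cs , sym (act-walk (proj₁ s) w Φ))
      where
      Ψ : Flag
      Ψ = walk r w Φ
      open ≡-Reasoning
      agree : act (proj₁ (step Φ s)) (rn Ψ) ≡ act (proj₁ (step Ψ s)) (rn Ψ)
      agree = begin
        act (proj₁ (step Φ s)) (rn Ψ)            ≡⟨ cong (act (proj₁ (step Φ s))) (rn-walk P w cs Φ) ⟩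
        act (proj₁ (step Φ s)) (walk r w (rn Φ)) ≡⟨ act-walk (proj₁ (step Φ s)) w (rn Φ) ⟩
        walk r w (act (proj₁ (step Φ s)) (rn Φ)) ≡⟨ cong (walk r w) (step-act Φ s) ⟨
        walk r w (rn′ (act (proj₁ s) Φ))         ≡⟨ rn-walk P′ w cs (act (proj₁ s) Φ) ⟨
        rn′ (walk r w (act (proj₁ s) Φ))         ≡⟨ cong rn′ (act-walk (proj₁ s) w Φ) ⟨
        rn′ (act (proj₁ s) Ψ)                    ≡⟨ step-act Ψ s ⟩
        act (proj₁ (step Ψ s)) (rn Ψ)            ∎

    run-respects : ∀ {γ δ} → γ ≈ᵂ[ rn ] δ → ∀ s → run γ s ≈ˢ run δ s
    run-respects ≈refl        s = λ _ → refl
    run-respects (≈sym p)     s = sym ∘ run-respects p s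
    run-respects (≈trans p q) s = λ Φ → trans (run-respects p s Φ) (run-respects q s Φ)
    run-respects (≈cong {w = γ} {γ′} {δ} {δ′} p q) s Φ = begin
      act (proj₁ (run (γ ++ δ) s)) Φ       ≡⟨ cong (λ t → act (proj₁ t) Φ) (run-++ γ δ s) ⟩
      act (proj₁ (run γ (run δ s))) Φ      ≡⟨ run-cong γ (run-respects q s) Φ ⟩
      act (proj₁ (run γ (run δ′ s))) Φ     ≡⟨ run-respects p (run δ′ s) Φ ⟩
      act (proj₁ (run γ′ (run δ′ s))) Φ    ≡⟨ cong (λ t → act (proj₁ t) Φ) (run-++ γ′ δ′ s) ⟨
      act (proj₁ (run (γ′ ++ δ′) s)) Φ     ∎
      where open ≡-Reasoning
    run-respects (≈inv true  Φ)               s = proj₁ (step-twice refl s)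
    run-respects (≈inv false Φ)               s = proj₁ (step-twice (rn-invol Φ) s)
    run-respects (≈facet (w , cs , refl))     s = proj₁ (step-facet w cs _ s)
    run-respects (≈rel Φ)                     s = proj₁ (step-twice (rn-invol Φ) s)

    translate-respects : ∀ {γ δ} → γ ≈ᵂ[ rn ] δ → ∀ s → translate γ s ≈ᵂ[ rn′ ] translate δ s
    translate-respects ≈refl        s = ≈refl
    translate-respects (≈sym p)     s = ≈sym (translate-respects p s)
    translate-respects (≈trans p q) s = ≈trans (translate-respects p s) (translate-respects q s)
    translate-respects (≈cong {w = γ} {γ′} {δ} {δ′} p q) s =
      ≈trans (≡⇒≈ (translate-++ γ δ s))
      (≈trans (≡⇒≈ (cong (_++ translate δ s) (translate-cong γ (run-respects q s))))
      (≈trans (≈cong (translate-respects p (run δ′ s)) (translate-respects q s))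
              (≈sym (≡⇒≈ (translate-++ γ′ δ′ s)))))
      where
      ≡⇒≈ : ∀ {α β} → α ≡ β → α ≈ᵂ[ rn′ ] β
      ≡⇒≈ refl = ≈refl
    translate-respects (≈inv true  Φ)           s = proj₂ (step-twice refl s)
    translate-respects (≈inv false Φ)           s = proj₂ (step-twice (rn-invol Φ) s)
    translate-respects (≈facet (w , cs , refl)) s = proj₂ (step-facet w cs _ s)
    translate-respects (≈rel Φ)                 s = proj₂ (step-twice (rn-invol Φ) s)

    s₀ : State
    s₀ = e , e∈S

    image : UFlag K → UFlag K
    image (Φ , γ) = act (proj₁ (run γ s₀)) Φ , translate γ s₀

    hom : Hom rn rn′
    hom = hom-intro image image-cong (λ j x → act-col (proj₁ (run (proj₂ x) s₀)) j (proj₁ x) , ≈refl)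
                    (λ x → sym (step-act (proj₁ x) (run (proj₂ x) s₀)) , ≈refl)
      where
      image-cong : ∀ {x y} → x ≈ᵁ[ rn ] y → image x ≈ᵁ[ rn′ ] image y
      image-cong {Φ , γ} {.Φ , δ} (refl , γ≈δ) = run-respects γ≈δ s₀ Φ , translate-respects γ≈δ s₀

    hom-base : ∀ Φ → map hom (Φ , []) ≈ᵁ[ rn′ ] (Φ , [])
    hom-base Φ = e-id Φ , ≈refl

  friendly⇒iso : (P P′ : PreExtender K) →
    let rn = PreExtender.rn P ; rn′ = PreExtender.rn P′ in
    (Σ (AutSet K) λ S → Friendly K rn rn′ S × ContainsId K S) →
    Σ (UIso K rn rn′) λ φ → ∀ Φ → UIso.to φ (Φ , []) ≈ᵁ[ rn′ ] (Φ , [])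
  friendly⇒iso P P′ (S , frS , e , e∈S , e-id) = iso , F.hom-base
    where
    module F = FriendlyHom P P′ frS e e∈S e-id
    module G = FriendlyHom P′ P (friendly-⁻¹ frS) (e ⁻¹ᴬ) (⁻¹ˢ-intro e∈S) (⁻¹ᴬ-id e e-id)
    iso : UIso K (PreExtender.rn P) (PreExtender.rn P′)
    iso = record
      { to        = map F.hom
      ; from      = map G.hom
      ; to-cong   = map-cong F.hom
      ; from-cong = map-cong G.hom
      ; to-from   = hom-unique (G.hom ·ᴴ F.hom) idᴴ
                      λ Φ → ≈ᵁ.trans (map-cong F.hom (G.hom-base Φ)) (F.hom-base Φ)
      ; from-to   = hom-unique (F.hom ·ᴴ G.hom) idᴴ
                      λ Φ → ≈ᵁ.trans (map-cong G.hom (F.hom-base Φ)) (G.hom-base Φ)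
      ; to-colour = map-colour F.hom }

open Theory

theorem5p22 : {n : ℕ} (K : Maniplex n) (P P′ : PreExtender K) →
    let rn = PreExtender.rn P
        rn′ = PreExtender.rn P′
    in ((Σ (UIso K rn rn′) λ φ → ∀ Φ → _≈U[_]_ K (UIso.to φ (Φ , [])) rn′ (Φ , []))
         ⇔ (Σ (AutSet K) λ S → Friendly K rn rn′ S × ContainsId K S))
       × ((Σ (AutSet K) λ S → Friendly K rn rn′ S × ContainsId K S)
         ⇔ QuotientEq K rn (Heart K rn) rn′ (Heart K rn′))
theorem5p22 K P P′ =
  mk⇔ (λ (φ , base) → iso⇒friendly K φ base) (friendly⇒iso K P P′) ,
  mk⇔ (λ (S , frS , cid) → friendly⇒quotientEq K frS cid) (quotientEq⇒friendly K)
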